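{- Let $k \geq 3$ and let $\mathcal{A}$ be a finite relational structure on the language $\{R\}$ with a single $k$-ary relation symbol $R$, where $R^{\mathcal{A}}$ is irreflexive, and $|\operatorname{dom}(\mathcal{A})| = n \geq k$. Then there is a simple structure $\mathcal{A}^*$ on the language $\{R\}$, with $R^{\mathcal{A}^*}$ irreflexive, $\operatorname{dom}(\mathcal{A}^*) = \operatorname{dom}(\mathcal{A}) \cup \{x\}$ for a new element $x$, and $R^{\mathcal{A}^*} \cap \operatorname{dom}(\mathcal{A})^k = R^{\mathcal{A}}$.
   Context: A $k$-ary relation $R$ is irreflexive if no tuple in $R$ has two equal entries. For a structure $\mathcal{B}$ with ground set $B$ and $k$-ary relation $R^{\mathcal{B}}$, a set $I \subseteq B$ is an interval if for every position $i \in \{1,\dots,k\}$, all $x,y \in I$ and all $(k-1)$-tuples $(x_1,\ldots,x_{i-1},x_{i+1},\ldots,x_k) \in B^{k-1}\setminus I^{k-1}$, we have $(x_1,\ldots,x_{i-1},x,x_{i+1},\ldots,x_k) \in R^{\mathcal{B}} \iff (x_1,\ldots,x_{i-1},y,x_{i+1},\ldots,x_k) \in R^{\mathcal{B}}$. The empty set, singletons and $B$ are intervals; others are proper. The structure is simple if it has no proper intervals. -}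

module Defs where

open import Data.Nat using (ℕ; suc)
open import Data.Fin using (Fin; inject₁; fromℕ)
open import Data.Vec using (Vec; lookup; _[_]≔_; map)
open import Data.Bool using (Bool; true)
open import Data.Product using (∃; _×_)
open import Data.Sum using (_⊎_)
open import Relation.Nullary using (¬_)
open import Relation.Binary.PropositionalEquality using (_≡_; _≢_)

KRel : ℕ → ℕ → Set
KRel k m = Vec (Fin m) k → Bool

Irreflexive : ∀ {k m} → KRel k m → Set
Irreflexive {k} R = ∀ (t : Vec (Fin _) k) → R t ≡ true →
  ∀ (i j : Fin k) → i ≢ j → lookup t i ≢ lookup t j

Subset : ℕ → Set
Subset m = Fin m → Bool

_∈_ : ∀ {m} → Fin m → Subset m → Set
x ∈ I = I x ≡ true

IsInterval : ∀ {k m} → KRel k m → Subset m → Set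
IsInterval {k} {m} R I =
  ∀ (i : Fin k) (x y : Fin m) → x ∈ I → y ∈ I →
  ∀ (t : Vec (Fin m) k) →
  ¬ (∀ (j : Fin k) → j ≢ i → lookup t j ∈ I) →
  R (t [ i ]≔ x) ≡ R (t [ i ]≔ y)

IsTrivialSubset : ∀ {m} → Subset m → Set
IsTrivialSubset {m} I =
  (∀ z → ¬ (z ∈ I))
  ⊎ (∃ λ a → ∀ z → z ∈ I → z ≡ a)
  ⊎ (∀ z → z ∈ I)

Simple : ∀ {k m} → KRel k m → Set
Simple R = ∀ I → IsInterval R I → IsTrivialSubset I

-- Extension of a structure on Fin n to Fin (suc n): the old domain is
-- embedded via inject₁ and the new element x is fromℕ n (the last element).
restrict : ∀ {k n} → KRel k (suc n) → KRel k n
restrict R t = R (map inject₁ t)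

-- Extend R by declaring every tuple with pairwise distinct entries that passes
-- through the new element x to be related. If I were a proper interval, pick p ≠ q in I
-- and r ∉ I with x ∈ {p, r}, and complete them to a tuple (p, q, r, …) of
-- distinct entries; it lies in the new relation. Since r ∉ I, the interval
-- condition at the first position lets us replace p by q, producing the tuple
-- (q, q, r, …), which irreflexivity forbids.
module Submission where

open import Defs
open import Data.Nat as ℕ using (ℕ; suc; _+_; _≤_; s≤s)
open import Data.Nat.Properties using (m≤n⇒m≤1+n)
open import Data.Fin using (Fin; zero; suc; toℕ; inject₁; inject≤; fromℕ; lower₁; _≟_)
open import Data.Fin.Properties
  using (all?; any?; inject₁-injective; toℕ-fromℕ; toℕ-inject₁-≢; lower₁-inject₁′; inject≤-injective)
open import Data.Fin.Permutation.Components using (transpose; transpose-inverse)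
open import Data.Vec using (Vec; []; _∷_; lookup; map; tabulate)
open import Data.Vec.Properties using (lookup-map; lookup∘tabulate)
open import Data.Vec.Effectful using (module TraversableA)
open import Data.Bool using (true; false)
open import Data.Bool.Properties using () renaming (_≟_ to _≟ᵇ_)
open import Data.Maybe as Maybe using (Maybe; just; nothing; maybe′)
open import Data.Maybe.Effectful using (applicative)
open import Data.Product using (∃; ∃₂; _×_; _,_)
open import Data.Sum using (_⊎_; inj₁; inj₂)
open import Data.Empty using (⊥-elim)
open import Function using (_∘_)
open import Function.Definitions using (Injective)
open import Level using (0ℓ)
open import Relation.Nullary using (¬_; Dec; yes; no)
open import Relation.Nullary.Decidable using (¬?; _×-dec_; _→-dec_; dec-true; dec-false; decidable-stable)
open import Relation.Binary.PropositionalEquality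
  using (_≡_; _≢_; refl; sym; trans; cong; subst; module ≡-Reasoning)

open TraversableA (applicative {0ℓ}) using (mapA)

private
  variable
    k m n : ℕ

Distinct : Vec (Fin m) k → Set
Distinct {k = k} t = ∀ (i j : Fin k) → i ≢ j → lookup t i ≢ lookup t j

distinct? : (t : Vec (Fin m) k) → Dec (Distinct t)
distinct? t = all? λ i → all? λ j → ¬? (i ≟ j) →-dec ¬? (lookup t i ≟ lookup t j)

map-distinct : ∀ {f : Fin m → Fin n} → Injective _≡_ _≡_ f →
  {t : Vec (Fin m) k} → Distinct t → Distinct (map f t)
map-distinct {f = f} f-inj {t} t-distinct i j i≢j fti≡ftj =
  t-distinct i j i≢j (f-inj (begin
    f (lookup t i)      ≡⟨ sym (lookup-map i f t) ⟩
    lookup (map f t) i  ≡⟨ fti≡ftj ⟩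
    lookup (map f t) j  ≡⟨ lookup-map j f t ⟩
    f (lookup t j)      ∎))
  where open ≡-Reasoning

tabulate-distinct : ∀ {f : Fin k → Fin m} → Injective _≡_ _≡_ f → Distinct (tabulate f)
tabulate-distinct {f = f} f-inj i j i≢j eq =
  i≢j (f-inj (trans (sym (lookup∘tabulate f i)) (trans eq (lookup∘tabulate f j))))

retarget : (Fin k → Fin m) → Fin k → Fin m → Fin k → Fin m
retarget f z v = transpose (f z) v ∘ f

transpose-injective : (i j : Fin m) → Injective _≡_ _≡_ (transpose i j)
transpose-injective i j {a} {b} eq = begin
  a                                    ≡⟨ sym (transpose-inverse j i) ⟩
  transpose j i (transpose i j a)      ≡⟨ cong (transpose j i) eq ⟩
  transpose j i (transpose i j b)      ≡⟨ transpose-inverse j i ⟩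
  b                                    ∎
  where open ≡-Reasoning

module _ {f : Fin k → Fin m} (f-inj : Injective _≡_ _≡_ f) (z : Fin k) (v : Fin m) where

  retarget-injective : Injective _≡_ _≡_ (retarget f z v)
  retarget-injective = f-inj ∘ transpose-injective (f z) v

  retarget-hit : retarget f z v z ≡ v
  retarget-hit rewrite dec-true (f z ≟ f z) refl = refl

  retarget-elsewhere : ∀ w → w ≢ z → f w ≢ v → retarget f z v w ≡ f w
  retarget-elsewhere w w≢z fw≢v
    rewrite dec-false (f w ≟ f z) (w≢z ∘ f-inj) | dec-false (f w ≟ v) fw≢v = refl

injective-through₃ : 3 + k ≤ m → ∀ {p q r : Fin m} → p ≢ q → p ≢ r → q ≢ r →
  ∃ λ (f : Fin (3 + k) → Fin m) →
    Injective _≡_ _≡_ f × f zero ≡ p × f (suc zero) ≡ q × f (suc (suc zero)) ≡ r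
injective-through₃ k≤m {p} {q} {r} p≢q p≢r q≢r =
  f₃ , f₃-inj , f₃0≡p , f₃1≡q , retarget-hit f₂-inj (suc (suc zero)) r
  where
  f₀ = λ i → inject≤ i k≤m
  f₀-inj : Injective _≡_ _≡_ f₀
  f₀-inj = inject≤-injective _ _ _ _
  f₁ = retarget f₀ zero p
  f₁-inj = retarget-injective f₀-inj zero p
  f₂ = retarget f₁ (suc zero) q
  f₂-inj = retarget-injective f₁-inj (suc zero) q
  f₃ = retarget f₂ (suc (suc zero)) r
  f₃-inj = retarget-injective f₂-inj (suc (suc zero)) r

  f₁0≡p : f₁ zero ≡ p
  f₁0≡p = retarget-hit f₀-inj zero p
  f₂1≡q : f₂ (suc zero) ≡ q
  f₂1≡q = retarget-hit f₁-inj (suc zero) q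
  f₂0≡p : f₂ zero ≡ p
  f₂0≡p = trans (retarget-elsewhere f₁-inj (suc zero) q zero (λ ()) (p≢q ∘ trans (sym f₁0≡p))) f₁0≡p
  f₃0≡p : f₃ zero ≡ p
  f₃0≡p = trans (retarget-elsewhere f₂-inj (suc (suc zero)) r zero (λ ()) (p≢r ∘ trans (sym f₂0≡p))) f₂0≡p
  f₃1≡q : f₃ (suc zero) ≡ q
  f₃1≡q = trans (retarget-elsewhere f₂-inj (suc (suc zero)) r (suc zero) (λ ()) (q≢r ∘ trans (sym f₂1≡q))) f₂1≡q

distinct-extension : 3 + k ≤ m → ∀ {p q r : Fin m} → p ≢ q → p ≢ r → q ≢ r →
  ∃ λ (rest : Vec (Fin m) k) → Distinct (p ∷ q ∷ r ∷ rest)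
distinct-extension k≤m p≢q p≢r q≢r
  with injective-through₃ k≤m p≢q p≢r q≢r
... | f , f-inj , refl , refl , refl = tabulate (λ i → f (suc (suc (suc i)))) , tabulate-distinct f-inj

lower₁? : Fin (suc n) → Maybe (Fin n)
lower₁? {n} i with n ℕ.≟ toℕ i
... | yes _   = nothing
... | no n≢i = just (lower₁ i n≢i)

lower₁?-inject₁ : (i : Fin n) → lower₁? (inject₁ i) ≡ just i
lower₁?-inject₁ {n} i with n ℕ.≟ toℕ (inject₁ i)
... | yes n≡i = ⊥-elim (toℕ-inject₁-≢ i n≡i)
... | no n≢i  = cong just (lower₁-inject₁′ i n≢i)

lower₁?-fromℕ : ∀ n → lower₁? (fromℕ n) ≡ nothing
lower₁?-fromℕ n with n ℕ.≟ toℕ (fromℕ n)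
... | yes _   = refl
... | no n≢n = ⊥-elim (n≢n (sym (toℕ-fromℕ n)))

mapA-map : ∀ {A B : Set} {f : B → Maybe A} {g : A → B} → (∀ a → f (g a) ≡ just a) →
  (t : Vec A k) → mapA f (map g t) ≡ just t
mapA-map f∘g≡just [] = refl
mapA-map f∘g≡just (a ∷ t) rewrite f∘g≡just a = cong (Maybe.map (a ∷_)) (mapA-map f∘g≡just t)

mapA-nothing : ∀ {A B : Set} {f : A → Maybe B} (t : Vec A k) (i : Fin k) →
  f (lookup t i) ≡ nothing → mapA f t ≡ nothing
mapA-nothing (a ∷ t) zero    fa≡nothing rewrite fa≡nothing = refl
mapA-nothing {f = f} (a ∷ t) (suc i) fti≡nothing with f a
... | nothing = refl
... | just b  = cong (Maybe.map (b ∷_)) (mapA-nothing t i fti≡nothing)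

-- mapA lower₁? t is nothing exactly when t passes through the new element fromℕ n.
extend : KRel k n → KRel k (suc n)
extend R t with distinct? t
... | no _  = false
... | yes _ = maybe′ R true (mapA lower₁? t)

extend-irreflexive : (R : KRel k n) → Irreflexive (extend R)
extend-irreflexive R t with distinct? t
... | no _           = λ ()
... | yes t-distinct = λ _ → t-distinct

extend-restrict : (R : KRel k n) → Irreflexive R → ∀ t → restrict (extend R) t ≡ R t
extend-restrict R R-irr t with distinct? (map inject₁ t)
... | yes _ = cong (maybe′ R true) (mapA-map lower₁?-inject₁ t)
... | no ¬distinct with R t in Rt
...   | false = refl
...   | true  = ⊥-elim (¬distinct (map-distinct {f = inject₁} inject₁-injective {t} (R-irr t Rt)))

extend-new : (R : KRel k n) (t : Vec (Fin (suc n)) k) (i : Fin k) →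
  lookup t i ≡ fromℕ n → Distinct t → extend R t ≡ true
extend-new {n = n} R t i ti≡x t-distinct with distinct? t
... | no ¬distinct = ⊥-elim (¬distinct t-distinct)
... | yes _ = cong (maybe′ R true) (mapA-nothing t i (trans (cong lower₁? ti≡x) (lower₁?-fromℕ n)))

interval-excludes-separating-tuple : ∀ {S : KRel (3 + k) m} {I} → Irreflexive S → IsInterval S I →
  ∀ {p q r rest} → p ∈ I → q ∈ I → ¬ r ∈ I → S (p ∷ q ∷ r ∷ rest) ≢ true
interval-excludes-separating-tuple {S = S} {I} S-irr I-interval {p} {q} {r} {rest} p∈I q∈I r∉I S-pqr =
  S-irr (q ∷ q ∷ r ∷ rest) S-qqr zero (suc zero) (λ ()) refl
  where
  S-qqr : S (q ∷ q ∷ r ∷ rest) ≡ true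
  S-qqr = trans (sym (I-interval zero p q p∈I q∈I (p ∷ q ∷ r ∷ rest) r-outside)) S-pqr
    where
    r-outside : ¬ (∀ j → j ≢ zero → lookup (p ∷ q ∷ r ∷ rest) j ∈ I)
    r-outside all∈I = r∉I (all∈I (suc (suc zero)) λ ())

trivial-or-proper : (I : Subset m) →
  IsTrivialSubset I ⊎ (∃₂ λ a b → a ∈ I × b ∈ I × a ≢ b × ∃ λ c → ¬ c ∈ I)
trivial-or-proper I with any? (λ z → I z ≟ᵇ true)
... | no ∄∈I = inj₁ (inj₁ λ z z∈I → ∄∈I (z , z∈I))
... | yes (a , a∈I) with any? (λ z → (I z ≟ᵇ true) ×-dec ¬? (z ≟ a))
...   | no ∄other = inj₁ (inj₂ (inj₁ (a , λ z z∈I → decidable-stable (z ≟ a) λ z≢a → ∄other (z , z∈I , z≢a))))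
...   | yes (b , b∈I , b≢a) with any? (λ z → ¬? (I z ≟ᵇ true))
...     | no ∄∉I = inj₁ (inj₂ (inj₂ λ z → decidable-stable (I z ≟ᵇ true) λ z∉I → ∄∉I (z , z∉I)))
...     | yes (c , c∉I) = inj₂ (a , b , a∈I , b∈I , b≢a ∘ sym , c , c∉I)

separating-triple : ∀ {I : Subset m} (x : Fin m) {a b c} → a ∈ I → b ∈ I → a ≢ b → ¬ c ∈ I →
  ∃₂ λ p q → ∃ λ r → p ∈ I × q ∈ I × ¬ r ∈ I × p ≢ q × (p ≡ x ⊎ r ≡ x)
separating-triple {I = I} x {a} {b} {c} a∈I b∈I a≢b c∉I with I x ≟ᵇ true | a ≟ x
... | no x∉I  | _       = a , b , x , a∈I , b∈I , x∉I , a≢b , inj₂ refl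
... | yes _   | yes a≡x = a , b , c , a∈I , b∈I , c∉I , a≢b , inj₁ a≡x
... | yes x∈I | no a≢x  = x , a , c , x∈I , a∈I , c∉I , a≢x ∘ sym , inj₁ refl

∈-∉-distinct : ∀ {I : Subset m} {s r} → s ∈ I → ¬ r ∈ I → s ≢ r
∈-∉-distinct {I = I} s∈I r∉I s≡r = r∉I (subst (_∈ I) s≡r s∈I)

lookup-first-or-third : ∀ {A : Set} {p q r x : A} (rest : Vec A k) →
  p ≡ x ⊎ r ≡ x → ∃ λ i → lookup (p ∷ q ∷ r ∷ rest) i ≡ x
lookup-first-or-third _ (inj₁ p≡x) = zero , p≡x
lookup-first-or-third _ (inj₂ r≡x) = suc (suc zero) , r≡x

extend-simple : 3 + k ≤ n → (R : KRel (3 + k) n) → Simple (extend R)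
extend-simple {n = n} k≤n R I I-interval with trivial-or-proper I
... | inj₁ trivial = trivial
... | inj₂ (a , b , a∈I , b∈I , a≢b , c , c∉I)
  with separating-triple (fromℕ n) a∈I b∈I a≢b c∉I
... | p , q , r , p∈I , q∈I , r∉I , p≢q , x∈pr
  with distinct-extension (m≤n⇒m≤1+n k≤n) p≢q (∈-∉-distinct p∈I r∉I) (∈-∉-distinct q∈I r∉I)
... | rest , distinct with lookup-first-or-third rest x∈pr
... | i , tᵢ≡x = ⊥-elim (interval-excludes-separating-tuple {S = extend R} (extend-irreflexive R) I-interval p∈I q∈I r∉I
                                      (extend-new R (p ∷ q ∷ r ∷ rest) i tᵢ≡x distinct))

theorem7p3 : ∀ (k n : ℕ) → 3 ≤ k → k ≤ n →
    ∀ (R : KRel k n) → Irreflexive R →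
    ∃ λ (R* : KRel k (suc n)) →
    Simple R* × Irreflexive R* × (∀ t → restrict R* t ≡ R t)
theorem7p3 (suc (suc (suc k))) n (s≤s (s≤s (s≤s _))) k≤n R R-irr =
  extend R , extend-simple k≤n R , extend-irreflexive R , extend-restrict R R-irr
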